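{- In the weighted Tower of Hanoi, suppose $w_{ij}=w_{ji}$ for all distinct $i,j\in\{1,2,3\}$. Then for all distinct pegs $i,j$ with third peg $k=6-i-j$ and all $n\ge 1$, $C_n^{i,j}=C_n^{j,i}$ and $$C_{n}^{i,j}=\begin{cases}\min\{w_{ij},\,w_{ik}+w_{kj}\} & \text{if } n=1,\\ \min\{C_{n-1}^{i,k}+C_{n-1}^{k,j}+w_{ij},\ 3C_{n-1}^{i,j}+w_{ik}+w_{kj}\} & \text{otherwise}.\end{cases}$$
   Context: Weighted Tower of Hanoi (WTH): three pegs $1,2,3$, $n\in\mathbb{N}_0$ discs of pairwise distinct diameters. A legal move takes the topmost disc of a peg $a$ to a different peg $b$ which is empty or whose topmost disc is larger; it costs $w_{ab}\ge 0$. An instance $(n,i,j)$, $i\neq j$, asks to transfer all $n$ discs from peg $i$ (initially stacked there) to peg $j$; a solution is a finite sequence of legal moves achieving this, its total cost is the sum of its move costs. $C_n^{i,j}$ denotes the minimum total cost of a solution, with $C_0^{i,j}=0$.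
   Formalization: The move costs $w_{ab}$ are nonnegative rationals rather than nonnegative reals. -}

module Defs where

open import Data.Nat using (ℕ)
open import Data.Fin using (Fin; zero; suc; _<_)
open import Data.Vec using (Vec; lookup; replicate; _[_]≔_)
open import Data.Product using (Σ; _×_)
open import Data.Rational using (ℚ; 0ℚ; _+_; _≤_)
open import Relation.Binary.PropositionalEquality using (_≡_; _≢_)

-- Pegs 1,2,3 of the paper are zero, suc zero, suc (suc zero).
Peg : Set
Peg = Fin 3

-- Third peg k = 6 - i - j (value irrelevant when i ≡ j).
third : Peg → Peg → Peg
third zero (suc zero) = suc (suc zero)
third (suc zero) zero = suc (suc zero)
third zero (suc (suc zero)) = suc zero
third (suc (suc zero)) zero = suc zero
third (suc zero) (suc (suc zero)) = zero
third (suc (suc zero)) (suc zero) = zero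
third _ _ = zero

-- A state of n discs: position of each disc; disc 0 is the smallest,
-- larger index = larger diameter. (On every peg the discs are stacked by size.)
Config : ℕ → Set
Config n = Vec Peg n

-- A legal move of the topmost disc of peg a to peg b:
-- disc d lies on a, no smaller disc lies on a (d is topmost on a),
-- and no smaller disc lies on b (b is empty or its top disc is larger).
data Move {n : ℕ} (s : Config n) (a b : Peg) : Config n → Set where
  mv : (d : Fin n) → a ≢ b → lookup s d ≡ a →
       (∀ e → e < d → (lookup s e ≢ a) × (lookup s e ≢ b)) →
       Move s a b (s [ d ]≔ b)

data Solves (w : Peg → Peg → ℚ) {n : ℕ} : Config n → Config n → ℚ → Set where
  done : ∀ {s} → Solves w s s 0ℚ
  step : ∀ {s s' t a b c} → Move s a b s' → Solves w s' t c →
         Solves w s t (w a b + c)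

IsMinCost : (Peg → Peg → ℚ) → ℕ → Peg → Peg → ℚ → Set
IsMinCost w n i j c =
  Solves w (replicate n i) (replicate n j) c ×
  (∀ c' → Solves w (replicate n i) (replicate n j) c' → c ≤ c')

{-# OPTIONS --safe #-}
-- The two strategies of the recurrence (park the smaller
-- discs on the third peg while the largest disc moves once, or shuttle them around while it
-- moves twice via the third peg) give solutions of cost C (n+1). Conversely, the largest disc
-- can only move while all smaller discs are stacked on the remaining peg, and between two such
-- moves the smaller discs perform an n-disc transfer costing at least C n. Hence a potential Φ
-- on the pairs (position of the largest disc, peg of the smaller tower) that satisfies the
-- Bellman inequality across every move of the largest disc bounds the cost of any solution
-- from below; with symmetric weights, Φ at the start is exactly the recurrence.
module Submission where

open import Defs
open import Data.Nat as ℕ using (ℕ; zero; suc; _∸_; s≤s; z≤n) renaming (_≤_ to _≤ℕ_; _<_ to _<ℕ_)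
import Data.Nat.Properties as ℕ
open import Data.Fin using (Fin; zero; suc; _≟_; inject₁; fromℕ; toℕ) renaming (_<_ to _<ᶠ_)
open import Data.Fin.Properties using (all?; toℕ-inject₁; toℕ-fromℕ; toℕ<n; ℕ<⇒inject₁<; ≤fromℕ; <-irrefl)
open import Data.Fin.Relation.Unary.Top using (view; ‵fromℕ; ‵inject₁)
open import Data.Vec using (Vec; []; _∷_; lookup; replicate; _[_]≔_; _∷ʳ_)
open import Data.Vec.Properties using (∷ʳ-injective; lookup-replicate)
open import Data.Product using (Σ; _×_; _,_; proj₁; proj₂)
open import Data.Sum using (inj₁; inj₂)
open import Data.Empty using (⊥-elim)
open import Relation.Nullary using (¬_; yes; no)
open import Data.Rational.Solver using (module +-*-Solver)
open +-*-Solver using (solve; _:+_; _:=_)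
open import Relation.Nullary.Decidable using (from-yes; _→-dec_; _×-dec_; ¬?)
open import Data.Rational using (ℚ; 0ℚ; _+_; _≤_; _⊓_)
open import Data.Rational.Properties
  using (module ≤-Reasoning; ≤-refl; ≤-trans; ≤-antisym; ≤-reflexive; +-mono-≤; +-monoˡ-≤; +-monoʳ-≤;
         +-0-commutativeMonoid; +-identityˡ; +-identityʳ; +-assoc; +-comm;
         ⊓-sel; ⊓-glb; p⊓q≤p; p⊓q≤q; mono-≤-distrib-⊓)
open import Relation.Binary.PropositionalEquality
open import Function using (_∘_; case_of_)
open import Algebra.Bundles using (CommutativeMonoid)
open import Algebra.Properties.CommutativeSemigroup
  (CommutativeMonoid.commutativeSemigroup +-0-commutativeMonoid) using (xy∙z≈xz∙y; x∙yz≈xz∙y)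

private
  variable
    A : Set
    n : ℕ

third-unique : ∀ a b c → a ≢ b → c ≢ a → c ≢ b → c ≡ third a b
third-unique = from-yes (all? λ a → all? λ b → all? λ c →
  ¬? (a ≟ b) →-dec ¬? (c ≟ a) →-dec ¬? (c ≟ b) →-dec c ≟ third a b)

third-comm : ∀ a b → third a b ≡ third b a
third-comm = from-yes (all? λ a → all? λ b → third a b ≟ third b a)

third-≢ : ∀ a b → a ≢ b → third a b ≢ a × third a b ≢ b
third-≢ = from-yes (all? λ a → all? λ b →
  ¬? (a ≟ b) →-dec (¬? (third a b ≟ a) ×-dec ¬? (third a b ≟ b)))

lookup-∷ʳ-inject₁ : ∀ (xs : Vec A n) x i → lookup (xs ∷ʳ x) (inject₁ i) ≡ lookup xs i
lookup-∷ʳ-inject₁ (y ∷ xs) x zero    = refl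
lookup-∷ʳ-inject₁ (y ∷ xs) x (suc i) = lookup-∷ʳ-inject₁ xs x i

lookup-∷ʳ-fromℕ : ∀ (xs : Vec A n) x → lookup (xs ∷ʳ x) (fromℕ n) ≡ x
lookup-∷ʳ-fromℕ []       x = refl
lookup-∷ʳ-fromℕ (y ∷ xs) x = lookup-∷ʳ-fromℕ xs x

[]≔-∷ʳ-inject₁ : ∀ (xs : Vec A n) x i y → (xs ∷ʳ x) [ inject₁ i ]≔ y ≡ (xs [ i ]≔ y) ∷ʳ x
[]≔-∷ʳ-inject₁ (z ∷ xs) x zero    y = refl
[]≔-∷ʳ-inject₁ (z ∷ xs) x (suc i) y = cong (z ∷_) ([]≔-∷ʳ-inject₁ xs x i y)

[]≔-∷ʳ-fromℕ : ∀ (xs : Vec A n) x y → (xs ∷ʳ x) [ fromℕ n ]≔ y ≡ xs ∷ʳ y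
[]≔-∷ʳ-fromℕ []       x y = refl
[]≔-∷ʳ-fromℕ (z ∷ xs) x y = cong (z ∷_) ([]≔-∷ʳ-fromℕ xs x y)

replicate-suc-∷ʳ : ∀ n (x : A) → replicate (suc n) x ≡ replicate n x ∷ʳ x
replicate-suc-∷ʳ zero    x = refl
replicate-suc-∷ʳ (suc n) x = cong (x ∷_) (replicate-suc-∷ʳ n x)

lookup-const⇒replicate : ∀ (xs : Vec A n) x → (∀ i → lookup xs i ≡ x) → xs ≡ replicate n x
lookup-const⇒replicate []       x eq = refl
lookup-const⇒replicate (y ∷ xs) x eq = cong₂ _∷_ (eq zero) (lookup-const⇒replicate xs x (eq ∘ suc))

p≤q⇒p≤q+r : ∀ {p q r} → 0ℚ ≤ r → p ≤ q → p ≤ q + r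
p≤q⇒p≤q+r {q = q} 0≤r p≤q = ≤-trans p≤q (≤-trans (≤-reflexive (sym (+-identityʳ q))) (+-monoʳ-≤ q 0≤r))

inject₁-<-cancel : ∀ {i j : Fin n} → inject₁ i <ᶠ inject₁ j → i <ᶠ j
inject₁-<-cancel {i = i} {j} = subst₂ ℕ._<_ (toℕ-inject₁ i) (toℕ-inject₁ j)

inject₁-<-mono : ∀ {i j : Fin n} → i <ᶠ j → inject₁ i <ᶠ inject₁ j
inject₁-<-mono {i = i} {j} = subst₂ ℕ._<_ (sym (toℕ-inject₁ i)) (sym (toℕ-inject₁ j))

inject₁<fromℕ : ∀ (i : Fin n) → inject₁ i <ᶠ fromℕ n
inject₁<fromℕ {n} i = ℕ<⇒inject₁< (subst (toℕ i ℕ.<_) (sym (toℕ-fromℕ n)) (toℕ<n i))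

fromℕ≮inject₁ : ∀ (i : Fin n) → ¬ fromℕ n <ᶠ inject₁ i
fromℕ≮inject₁ i lt = ℕ.<⇒≱ lt (≤fromℕ (inject₁ i))

-- The last entry of a configuration is the position of its largest disc.
data SplitMove {n : ℕ} : Config n → Peg → Peg → Peg → Config (suc n) → Set where
  small : ∀ {σ σ′ x a b} → Move σ a b σ′ → SplitMove σ x a b (σ′ ∷ʳ x)
  large : ∀ {a b c} → a ≢ b → c ≢ a → c ≢ b → SplitMove (replicate n c) a a b (replicate n c ∷ʳ b)

splitMove : ∀ {σ : Config n} {x a b τ} → Move (σ ∷ʳ x) a b τ → SplitMove σ x a b τ
splitMove {n} {σ} {x} {a} {b} (mv d a≢b d-on-a d-top) with view d
... | ‵inject₁ i = subst (SplitMove σ x a b) (sym ([]≔-∷ʳ-inject₁ σ x i b))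
        (small (mv i a≢b (trans (sym (lookup-∷ʳ-inject₁ σ x i)) d-on-a) i-top))
  where
  i-top : ∀ e → e <ᶠ i → lookup σ e ≢ a × lookup σ e ≢ b
  i-top e e<i = subst (λ y → y ≢ a × y ≢ b) (lookup-∷ʳ-inject₁ σ x e) (d-top (inject₁ e) (inject₁-<-mono e<i))
... | ‵fromℕ = subst (SplitMove σ x a b) (sym ([]≔-∷ʳ-fromℕ σ x b))
        (largest (trans (sym (lookup-∷ʳ-fromℕ σ x)) d-on-a) (lookup-const⇒replicate σ (third a b) σ-on-third))
  where
  σ-on-third : ∀ e → lookup σ e ≡ third a b
  σ-on-third e with d-top (inject₁ e) (inject₁<fromℕ e)
  ... | e≢a , e≢b rewrite lookup-∷ʳ-inject₁ σ x e = third-unique a b (lookup σ e) a≢b e≢a e≢b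
  largest : x ≡ a → σ ≡ replicate n (third a b) → SplitMove σ x a b (σ ∷ʳ b)
  largest refl refl = large a≢b (proj₁ (third-≢ a b a≢b)) (proj₂ (third-≢ a b a≢b))

unsplitMove : ∀ {σ : Config n} {x a b τ} → SplitMove σ x a b τ → Move (σ ∷ʳ x) a b τ
unsplitMove {x = x} (small {σ} {a = a} {b} (mv i a≢b i-on-a i-top)) =
  subst (Move (σ ∷ʳ x) a b) ([]≔-∷ʳ-inject₁ σ x i b)
    (mv (inject₁ i) a≢b (trans (lookup-∷ʳ-inject₁ σ x i) i-on-a) top)
  where
  top : ∀ e → e <ᶠ inject₁ i → lookup (σ ∷ʳ x) e ≢ a × lookup (σ ∷ʳ x) e ≢ b
  top e e<i with view e
  ... | ‵inject₁ e′ rewrite lookup-∷ʳ-inject₁ σ x e′ = i-top e′ (inject₁-<-cancel e<i)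
  ... | ‵fromℕ = ⊥-elim (fromℕ≮inject₁ i e<i)
unsplitMove {n} (large {a} {b} {c} a≢b c≢a c≢b) =
  subst (Move (replicate n c ∷ʳ a) a b) ([]≔-∷ʳ-fromℕ (replicate n c) a b)
    (mv (fromℕ n) a≢b (lookup-∷ʳ-fromℕ (replicate n c) a) top)
  where
  top : ∀ e → e <ᶠ fromℕ n → lookup (replicate n c ∷ʳ a) e ≢ a × lookup (replicate n c ∷ʳ a) e ≢ b
  top e e<top with view e
  ... | ‵inject₁ e′ rewrite lookup-∷ʳ-inject₁ (replicate n c) a e′ | lookup-replicate e′ c = c≢a , c≢b
  ... | ‵fromℕ = ⊥-elim (<-irrefl refl e<top)

module _ {w : Peg → Peg → ℚ} where

  infixr 5 _++ˢ_
  infixl 5 _▷_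

  _++ˢ_ : ∀ {s t u : Config n} {c d} → Solves w s t c → Solves w t u d → Solves w s u (c + d)
  done ++ˢ r′ = subst (Solves w _ _) (sym (+-identityˡ _)) r′
  step {a = a} {b} {c} m r ++ˢ r′ = subst (Solves w _ _) (sym (+-assoc (w a b) c _)) (step m (r ++ˢ r′))

  _▷_ : ∀ {s t u : Config n} {c a b} → Solves w s t c → Move t a b u → Solves w s u (c + w a b)
  _▷_ {c = c} {a} {b} r m = subst (Solves w _ _) (cong (c +_) (+-identityʳ (w a b))) (r ++ˢ step m done)

  solves-∷ʳ : ∀ {σ τ : Config n} {c} x → Solves w σ τ c → Solves w (σ ∷ʳ x) (τ ∷ʳ x) c
  solves-∷ʳ x done       = done
  solves-∷ʳ x (step m r) = step (unsplitMove (small m)) (solves-∷ʳ x r)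

  solves-⊓ : ∀ {s t : Config n} {c d} → Solves w s t c → Solves w s t d → Solves w s t (c ⊓ d)
  solves-⊓ {c = c} {d} r r′ with ⊓-sel c d
  ... | inj₁ c⊓d≡c = subst (Solves w _ _) (sym c⊓d≡c) r
  ... | inj₂ c⊓d≡d = subst (Solves w _ _) (sym c⊓d≡d) r′

  solves-nonNeg : (∀ a b → a ≢ b → 0ℚ ≤ w a b) → ∀ {s t : Config n} {c} → Solves w s t c → 0ℚ ≤ c
  solves-nonNeg w≥0 done = ≤-refl
  solves-nonNeg w≥0 (step (mv _ a≢b _ _) r) = +-mono-≤ (w≥0 _ _ a≢b) (solves-nonNeg w≥0 r)

  isMinCost-unique : ∀ {i j c d} → IsMinCost w n i j c → IsMinCost w n i j d → c ≡ d
  isMinCost-unique (r , c-min) (r′ , d-min) = ≤-antisym (c-min _ r′) (d-min _ r)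

module _ {w : Peg → Peg → ℚ} {n : ℕ} (D : Peg → Peg → ℚ)
         (D-lower : ∀ {p q c} → Solves w (replicate n p) (replicate n q) c → D p q ≤ c)
         (j : Peg) (Φ : Peg → Peg → ℚ)
         (Φ-goal : ∀ p → Φ j p ≤ D p j)
         (Φ-step : ∀ {x b c} p → x ≢ b → c ≢ x → c ≢ b → Φ x p ≤ D p c + w x b + Φ b c) where

  potential-lower-bound : ∀ {S σ x p c c₀} → Solves w S (replicate (suc n) j) c → S ≡ σ ∷ʳ x →
                          Solves w (replicate n p) σ c₀ → Φ x p ≤ c₀ + c
  potential-lower-bound {σ = σ} {c₀ = c₀} done S≡σ∷ʳx r₀
    with ∷ʳ-injective σ (replicate n j) (trans (sym S≡σ∷ʳx) (replicate-suc-∷ʳ n j))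
  ... | refl , refl = ≤-trans (Φ-goal _) (≤-trans (D-lower r₀) (≤-reflexive (sym (+-identityʳ c₀))))
  potential-lower-bound {p = p} {c₀ = c₀} (step {c = c} m r) refl r₀ with splitMove m
  ... | small {a = a} {b} m′ =
    ≤-trans (potential-lower-bound r refl (r₀ ▷ m′)) (≤-reflexive (+-assoc c₀ (w a b) c))
  ... | large {a} {b} {q} a≢b q≢a q≢b = begin
    Φ a p                    ≤⟨ Φ-step p a≢b q≢a q≢b ⟩
    D p q + w a b + Φ b q    ≤⟨ +-mono-≤ (+-monoˡ-≤ (w a b) (D-lower r₀)) (potential-lower-bound r refl done) ⟩
    c₀ + w a b + (0ℚ + c)    ≡⟨ cong (c₀ + w a b +_) (+-identityˡ c) ⟩
    c₀ + w a b + c           ≡⟨ +-assoc c₀ (w a b) c ⟩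
    c₀ + (w a b + c)         ∎
    where open ≤-Reasoning

module Symmetric (w : Peg → Peg → ℚ)
                 (w≥0 : ∀ a b → a ≢ b → 0ℚ ≤ w a b)
                 (w-sym : ∀ a b → a ≢ b → w a b ≡ w b a) where

  recurrence : (Peg → Peg → ℚ) → Peg → Peg → ℚ
  recurrence D a b = (D a k + D k b + w a b) ⊓ (D a b + D a b + D a b + w a k + w k b)
    where k = third a b

  C : ℕ → Peg → Peg → ℚ
  C zero    a b = 0ℚ
  C (suc n) a b with a ≟ b
  ... | yes _ = 0ℚ
  ... | no  _ = recurrence (C n) a b

  C-diag : ∀ n a → C n a a ≡ 0ℚ
  C-diag zero    a = refl
  C-diag (suc n) a with a ≟ a
  ... | yes _  = refl
  ... | no a≢a = ⊥-elim (a≢a refl)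

  C-suc : ∀ {n a b} → a ≢ b → C (suc n) a b ≡ recurrence (C n) a b
  C-suc {a = a} {b} a≢b with a ≟ b
  ... | yes a≡b = ⊥-elim (a≢b a≡b)
  ... | no  _   = refl

  recurrence-comm : ∀ {D} → (∀ a b → D a b ≡ D b a) → ∀ {a b} → a ≢ b → recurrence D a b ≡ recurrence D b a
  recurrence-comm {D} D-comm {a} {b} a≢b = begin
    recurrence D a b
      ≡⟨ cong₂ _⊓_ via-third around ⟩
    (D b k + D k a + w b a) ⊓ (D b a + D b a + D b a + w b k + w k a)
      ≡⟨ cong (λ m → (D b m + D m a + w b a) ⊓ (D b a + D b a + D b a + w b m + w m a)) (third-comm a b) ⟩
    recurrence D b a ∎
    where
    open ≡-Reasoning
    k = third a b
    via-third : D a k + D k b + w a b ≡ D b k + D k a + w b a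
    via-third rewrite D-comm a k | D-comm k b | w-sym a b a≢b = cong (_+ w b a) (+-comm (D k a) (D b k))
    around : D a b + D a b + D a b + w a k + w k b ≡ D b a + D b a + D b a + w b k + w k a
    around rewrite D-comm a b | w-sym a k (proj₁ (third-≢ a b a≢b) ∘ sym)
                 | w-sym k b (proj₂ (third-≢ a b a≢b)) =
      xy∙z≈xz∙y (D b a + D b a + D b a) (w k a) (w b k)

  C-comm : ∀ n a b → C n a b ≡ C n b a
  C-comm zero    a b = refl
  C-comm (suc n) a b = case a ≟ b of λ where
    (yes refl) → refl
    (no a≢b)   → trans (C-suc a≢b) (trans (recurrence-comm (C-comm n) a≢b) (sym (C-suc (a≢b ∘ sym))))

  -- Φ n j x p: the cheaper way to finish on j with the largest of n + 1 discs on x and the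
  -- others stacked on p; the largest disc moves either directly to j or via m.
  Φ : ℕ → Peg → Peg → Peg → ℚ
  Φ n j x p with x ≟ j
  ... | yes _ = C n p j
  ... | no  _ = (C n p m + C n m j + w x j) ⊓ (C n p j + C n j x + C n x j + w x m + w m j)
    where m = third x j

  Φ-target : ∀ n j p → Φ n j j p ≡ C n p j
  Φ-target n j p with j ≟ j
  ... | yes _  = refl
  ... | no j≢j = ⊥-elim (j≢j refl)

  Φ-other : ∀ {n j x m} p → x ≢ j → third x j ≡ m →
            Φ n j x p ≡ (C n p m + C n m j + w x j) ⊓ (C n p j + C n j x + C n x j + w x m + w m j)
  Φ-other {j = j} {x} p x≢j refl with x ≟ j
  ... | yes x≡j = ⊥-elim (x≢j x≡j)
  ... | no  _   = refl

  C-suc≡Φ : ∀ {n p q} → p ≢ q → C (suc n) p q ≡ Φ n q p p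
  C-suc≡Φ {n} {p} {q} p≢q = begin
    C (suc n) p q
      ≡⟨ C-suc p≢q ⟩
    (C n p k + C n k q + w p q) ⊓ (C n p q + C n p q + C n p q + w p k + w k q)
      ≡⟨ cong (λ d → (C n p k + C n k q + w p q) ⊓ (C n p q + d + C n p q + w p k + w k q)) (C-comm n p q) ⟩
    (C n p k + C n k q + w p q) ⊓ (C n p q + C n q p + C n p q + w p k + w k q)
      ≡⟨ sym (Φ-other p p≢q refl) ⟩
    Φ n q p p ∎
    where
    open ≡-Reasoning
    k = third p q

  module InductiveStep {n : ℕ} (C-min : ∀ p q → IsMinCost w n p q (C n p q)) where

    open ≤-Reasoning

    C-solves : ∀ p q → Solves w (replicate n p) (replicate n q) (C n p q)
    C-solves p q = proj₁ (C-min p q)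

    C-lower : ∀ {p q c} → Solves w (replicate n p) (replicate n q) c → C n p q ≤ c
    C-lower r = proj₂ (C-min _ _) _ r

    C-nonNeg : ∀ p q → 0ℚ ≤ C n p q
    C-nonNeg p q = solves-nonNeg w≥0 (C-solves p q)

    C-triangle : ∀ p q r → C n p r ≤ C n p q + C n q r
    C-triangle p q r = C-lower (C-solves p q ++ˢ C-solves q r)

    C≤Φ : ∀ j x p → C n p j ≤ Φ n j x p
    C≤Φ j x p with x ≟ j
    ... | yes _ = ≤-refl
    ... | no x≢j = ⊓-glb
      (p≤q⇒p≤q+r (w≥0 x j x≢j) (C-triangle p (third x j) j))
      (p≤q⇒p≤q+r (w≥0 _ _ m≢j) (p≤q⇒p≤q+r (w≥0 _ _ (m≢x ∘ sym))
        (p≤q⇒p≤q+r (C-nonNeg x j) (p≤q⇒p≤q+r (C-nonNeg j x) ≤-refl))))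
      where
      m≢x = proj₁ (third-≢ x j x≢j)
      m≢j = proj₂ (third-≢ x j x≢j)

    Φ-step-from-target : ∀ j {b c} p → j ≢ b → Φ n j j p ≤ C n p c + w j b + Φ n j b c
    Φ-step-from-target j {b} {c} p j≢b = begin
      Φ n j j p                    ≡⟨ Φ-target n j p ⟩
      C n p j                      ≤⟨ C-triangle p c j ⟩
      C n p c + C n c j            ≤⟨ +-monoʳ-≤ (C n p c) (C≤Φ j b c) ⟩
      C n p c + Φ n j b c          ≤⟨ +-monoˡ-≤ (Φ n j b c) (p≤q⇒p≤q+r (w≥0 j b j≢b) (≤-refl {C n p c})) ⟩
      C n p c + w j b + Φ n j b c  ∎

    Φ-step-to-target : ∀ j {x c} p → x ≢ j → third x j ≡ c → Φ n j x p ≤ C n p c + w x j + Φ n j j c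
    Φ-step-to-target j {x} {c} p x≢j m≡c = begin
      Φ n j x p                    ≡⟨ Φ-other p x≢j m≡c ⟩
      (C n p c + C n c j + w x j) ⊓ _
                                   ≤⟨ p⊓q≤p (C n p c + C n c j + w x j) _ ⟩
      C n p c + C n c j + w x j    ≡⟨ xy∙z≈xz∙y (C n p c) (C n c j) (w x j) ⟩
      C n p c + w x j + C n c j    ≡⟨ cong (C n p c + w x j +_) (sym (Φ-target n j c)) ⟩
      C n p c + w x j + Φ n j j c  ∎

    Φ-step-avoiding-target : ∀ j {x b} p → x ≢ j → b ≢ j → x ≢ b →
                             Φ n j x p ≤ C n p j + w x b + Φ n j b j
    Φ-step-avoiding-target j {x} {b} p x≢j b≢j x≢b = begin
      Φ n j x p
        ≤⟨ ⊓-glb Φ≤+U Φ≤+V ⟩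
      (C n p j + w x b + U) ⊓ (C n p j + w x b + V)
        ≡⟨ sym (mono-≤-distrib-⊓ (+-monoʳ-≤ (C n p j + w x b)) U V) ⟩
      C n p j + w x b + (U ⊓ V)
        ≡⟨ cong (C n p j + w x b +_) (sym (Φ-other j b≢j (sym (third-unique b j x b≢j x≢b x≢j)))) ⟩
      C n p j + w x b + Φ n j b j ∎
      where
      U = C n j x + C n x j + w b j
      V = C n j j + C n j b + C n b j + w b x + w x j
      direct = C n p b + C n b j + w x j
      around = C n p j + C n j x + C n x j + w x b + w b j
      Φx≡ : Φ n j x p ≡ direct ⊓ around
      Φx≡ = Φ-other p x≢j (sym (third-unique x j b x≢j (x≢b ∘ sym) b≢j))
      Φ≤+U : Φ n j x p ≤ C n p j + w x b + U
      Φ≤+U = begin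
        Φ n j x p                                    ≡⟨ Φx≡ ⟩
        direct ⊓ around                              ≤⟨ p⊓q≤q direct around ⟩
        C n p j + C n j x + C n x j + w x b + w b j  ≡⟨ solve 5 (λ c₁ c₂ c₃ w₁ w₂ →
                                                          c₁ :+ c₂ :+ c₃ :+ w₁ :+ w₂ := c₁ :+ w₁ :+ (c₂ :+ c₃ :+ w₂))
                                                        refl (C n p j) (C n j x) (C n x j) (w x b) (w b j) ⟩
        C n p j + w x b + U                          ∎
      Φ≤+V : Φ n j x p ≤ C n p j + w x b + V
      Φ≤+V = begin
        Φ n j x p                            ≡⟨ Φx≡ ⟩
        direct ⊓ around                      ≤⟨ p⊓q≤p direct around ⟩
        C n p b + C n b j + w x j            ≤⟨ +-monoˡ-≤ (w x j) (+-monoˡ-≤ (C n b j) (C-triangle p j b)) ⟩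
        C n p j + C n j b + C n b j + w x j  ≤⟨ p≤q⇒p≤q+r (C-nonNeg j j) (p≤q⇒p≤q+r (w≥0 b x (x≢b ∘ sym))
                                                  (p≤q⇒p≤q+r (w≥0 x b x≢b) ≤-refl)) ⟩
        C n p j + C n j b + C n b j + w x j + w x b + w b x + C n j j
          ≡⟨ solve 7 (λ c₁ c₂ c₃ w₁ w₂ w₃ c₀ →
                 c₁ :+ c₂ :+ c₃ :+ w₁ :+ w₂ :+ w₃ :+ c₀ := c₁ :+ w₂ :+ (c₀ :+ c₂ :+ c₃ :+ w₃ :+ w₁))
               refl (C n p j) (C n j b) (C n b j) (w x j) (w x b) (w b x) (C n j j) ⟩
        C n p j + w x b + V                  ∎

    Φ-step : ∀ j {x b c} p → x ≢ b → c ≢ x → c ≢ b → Φ n j x p ≤ C n p c + w x b + Φ n j b c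
    Φ-step j {x} {b} {c} p x≢b c≢x c≢b = case ((x ≟ j) , (b ≟ j)) of λ where
      (yes refl , _)      → Φ-step-from-target x p x≢b
      (no x≢j , yes refl) → Φ-step-to-target b p x≢j (sym (third-unique x b c x≢j c≢x c≢b))
      (no x≢j , no b≢j)   → subst (λ c → Φ n j x p ≤ C n p c + w x b + Φ n j b c)
                                  (trans (third-unique x b j x≢b (x≢j ∘ sym) (b≢j ∘ sym))
                                         (sym (third-unique x b c x≢b c≢x c≢b)))
                                  (Φ-step-avoiding-target j p x≢j b≢j x≢b)

    C-suc-lower : ∀ {p q c} → Solves w (replicate (suc n) p) (replicate (suc n) q) c → C (suc n) p q ≤ c
    C-suc-lower {p} {q} {c} r = case p ≟ q of λ where
      (yes refl) → ≤-trans (≤-reflexive (C-diag (suc n) p)) (solves-nonNeg w≥0 r)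
      (no p≢q)   → begin
        C (suc n) p q  ≡⟨ C-suc≡Φ p≢q ⟩
        Φ n q p p      ≤⟨ potential-lower-bound (C n) C-lower q (Φ n q) (≤-reflexive ∘ Φ-target n q) (Φ-step q)
                            r (replicate-suc-∷ʳ n p) done ⟩
        0ℚ + c         ≡⟨ +-identityˡ c ⟩
        c              ∎

    solves-via-third : ∀ {p q} → p ≢ q → Solves w (replicate n p ∷ʳ p) (replicate n q ∷ʳ q)
                                          (C n p (third p q) + C n (third p q) q + w p q)
    solves-via-third {p} {q} p≢q = subst (Solves w _ _) (x∙yz≈xz∙y (C n p k) (w p q) (C n k q))
      (solves-∷ʳ p (C-solves p k) ++ˢ step (unsplitMove (large p≢q k≢p k≢q)) (solves-∷ʳ q (C-solves k q)))
      where
      k = third p q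
      k≢p = proj₁ (third-≢ p q p≢q)
      k≢q = proj₂ (third-≢ p q p≢q)

    solves-around : ∀ {p q} → p ≢ q → Solves w (replicate n p ∷ʳ p) (replicate n q ∷ʳ q)
                                       (C n p q + C n p q + C n p q + w p (third p q) + w (third p q) q)
    solves-around {p} {q} p≢q = subst (Solves w _ _) cost
      (solves-∷ʳ p (C-solves p q) ++ˢ step (unsplitMove (large (k≢p ∘ sym) (p≢q ∘ sym) (k≢q ∘ sym)))
        (solves-∷ʳ k (C-solves q p) ++ˢ step (unsplitMove (large k≢q (k≢p ∘ sym) p≢q))
          (solves-∷ʳ q (C-solves p q))))
      where
      k = third p q
      k≢p = proj₁ (third-≢ p q p≢q)
      k≢q = proj₂ (third-≢ p q p≢q)
      cost : C n p q + (w p k + (C n q p + (w k q + C n p q))) ≡ C n p q + C n p q + C n p q + w p k + w k q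
      cost rewrite C-comm n q p = solve 3 (λ d x y → d :+ (x :+ (d :+ (y :+ d))) := d :+ d :+ d :+ x :+ y)
                                    refl (C n p q) (w p k) (w k q)

    C-suc-solves : ∀ p q → Solves w (replicate (suc n) p) (replicate (suc n) q) (C (suc n) p q)
    C-suc-solves p q = case p ≟ q of λ where
      (yes refl) → subst (Solves w _ _) (sym (C-diag (suc n) p)) done
      (no p≢q)   → subst (Solves w _ _) (sym (C-suc p≢q))
                     (subst₂ (λ s t → Solves w s t (recurrence (C n) p q))
                             (sym (replicate-suc-∷ʳ n p)) (sym (replicate-suc-∷ʳ n q))
                       (solves-⊓ (solves-via-third p≢q) (solves-around p≢q)))

    C-suc-isMinCost : ∀ p q → IsMinCost w (suc n) p q (C (suc n) p q)
    C-suc-isMinCost p q = C-suc-solves p q , λ _ → C-suc-lower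

  C-isMinCost : ∀ n p q → IsMinCost w n p q (C n p q)
  C-isMinCost zero    p q = done , λ _ → solves-nonNeg w≥0
  C-isMinCost (suc n) p q = InductiveStep.C-suc-isMinCost (C-isMinCost n) p q

  isMinCost⇒≡C : ∀ {n i j c} → IsMinCost w n i j c → c ≡ C n i j
  isMinCost⇒≡C c-min = isMinCost-unique c-min (C-isMinCost _ _ _)

  C-one : ∀ {i j} → i ≢ j → C 1 i j ≡ w i j ⊓ (w i (third i j) + w (third i j) j)
  C-one {i} {j} i≢j = trans (C-suc i≢j)
    (cong₂ _⊓_ (+-identityˡ (w i j)) (cong (_+ w (third i j) j) (+-identityˡ (w i (third i j)))))

  isMinCost-recurrence : ∀ {n i j c a b d} → i ≢ j →
    IsMinCost w (suc n) i j c → IsMinCost w n i (third i j) a →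
    IsMinCost w n (third i j) j b → IsMinCost w n i j d →
    c ≡ (a + b + w i j) ⊓ (d + d + d + w i (third i j) + w (third i j) j)
  isMinCost-recurrence i≢j c-min a-min b-min d-min
    rewrite isMinCost⇒≡C c-min | isMinCost⇒≡C a-min | isMinCost⇒≡C b-min | isMinCost⇒≡C d-min = C-suc i≢j

corollary3 : (w : Peg → Peg → ℚ) →
             (∀ a b → a ≢ b → 0ℚ ≤ w a b) →
             (∀ a b → a ≢ b → w a b ≡ w b a) →
             (n : ℕ) → 1 ≤ℕ n → (i j : Peg) → i ≢ j →
             (Σ ℚ (λ c → IsMinCost w n i j c)) ×
             (∀ c c' → IsMinCost w n i j c → IsMinCost w n j i c' → c ≡ c') ×
             (n ≡ 1 → ∀ c → IsMinCost w n i j c →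
                c ≡ w i j ⊓ (w i (third i j) + w (third i j) j)) ×
             (1 <ℕ n → ∀ c a b d →
                IsMinCost w n i j c →
                IsMinCost w (n ∸ 1) i (third i j) a →
                IsMinCost w (n ∸ 1) (third i j) j b →
                IsMinCost w (n ∸ 1) i j d →
                c ≡ (a + b + w i j) ⊓ (d + d + d + w i (third i j) + w (third i j) j))
corollary3 w w≥0 w-sym n@(suc _) (s≤s z≤n) i j i≢j =
  (C n i j , C-isMinCost n i j) ,
  (λ c c′ c-min c′-min → trans (isMinCost⇒≡C c-min) (trans (C-comm n i j) (sym (isMinCost⇒≡C c′-min)))) ,
  (λ { refl c c-min → trans (isMinCost⇒≡C c-min) (C-one i≢j) }) ,
  (λ _ _ _ _ _ → isMinCost-recurrence i≢j)
  where open Symmetric w w≥0 w-sym
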